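{- Let $G$ be an interval graph or an interval-overlap graph, and let $p\geq1$. If an il-representation matrix $A$ of $G$ contains a $(2p+1)$-mixed minor, then for every permutation $\pi$ of $p$ elements there is a $p\times p$ submatrix $A'$ of $A$ equal to the permutation matrix $P_\pi$, such that for every two distinct rows of $A'$ indexed by $(s_1,s_2)$ and $(t_1,t_2)$ we have $s_1\neq t_1$.
   Context: Interval graphs: intersection graphs of intervals on the line; interval-overlap graphs: intervals adjacent iff they intersect and neither strictly contains the other (strictly w.r.t. both ends). An interval-like representation of $G$ is $(S,\leq,\eta,\phi)$ where $(S,\leq)$ is a finite linear order, $\eta\subseteq S\times S$ with $(s_1,s_2)\in\eta\Rightarrow s_1\leq s_2$, $V(G)=\eta$, and adjacency of distinct vertices is given by a predicate $\phi$ on their ends. The il-representation matrix is the $R\times S$ matrix with $R=\eta\cup\{(t,t):t\in S\}$, rows ordered lexicographically by $\leq$, columns ordered by $\leq$, and for $i=(s_1,s_2)\in R$, $j\in S$: $a_{i,j}=2$ iff $j<s_1$, $a_{i,j}=1$ iff $i\in\eta$ and $j=s_2$, else $0$. A submatrix is obtained by choosing row and column subsets (keeping order). The permutation matrix of $\pi$ on $\{1,\dots,p\}$ has entry $1$ at $(i,j)$ iff $\pi(i)=j$ and $0$ otherwise. A $k$-mixed minor of an ordered matrix is a partition of rows and of columns each into $k$ nonempty consecutive parts such that every one of the $k\times k$ zones contains at least two distinct rows and at least two distinct columns. -}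

module Defs where

open import Data.Nat using (ℕ; zero; suc)
open import Data.Fin using (Fin; toℕ; _<_; _≤_; _<?_; _≟_)
open import Data.Bool using (Bool; true; false; _∨_; _∧_; if_then_else_)
open import Data.List using (List; allFin; concatMap; map; filterᵇ; length; lookup)
open import Data.Product using (_×_; _,_; proj₁; proj₂; Σ; ∃; ∃₂)
open import Data.Sum using (_⊎_)
open import Relation.Nullary using (¬_)
open import Relation.Nullary.Decidable using (⌊_⌋)
open import Relation.Binary.PropositionalEquality using (_≡_; _≢_)
open import Function.Definitions using (Surjective)

-- The finite linear order (S, ≤) is taken to be Fin n with its natural
-- order (every finite linear order is isomorphic to one of these).
-- η ⊆ S × S is given by its (Boolean) characteristic function, and we
-- require (s₁ , s₂) ∈ η ⇒ s₁ ≤ s₂.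

Pair : ℕ → Set
Pair n = Fin n × Fin n

record ILRep (n : ℕ) : Set where
  field
    η     : Fin n → Fin n → Bool
    η-ord : ∀ s₁ s₂ → η s₁ s₂ ≡ true → s₁ ≤ s₂
open ILRep public

_∈η_ : ∀ {n} → Pair n → ILRep n → Set
(s₁ , s₂) ∈η ρ = η ρ s₁ s₂ ≡ true

data Kind : Set where
  intervalG overlapG : Kind

Intersect : ∀ {n} → Pair n → Pair n → Set
Intersect (s₁ , s₂) (t₁ , t₂) = (s₁ ≤ t₂) × (t₁ ≤ s₂)

StrictlyContains : ∀ {n} → Pair n → Pair n → Set
StrictlyContains (s₁ , s₂) (t₁ , t₂) = (s₁ < t₁) × (t₂ < s₂)

φ : Kind → ∀ {n} → Pair n → Pair n → Set
φ intervalG u v = Intersect u v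
φ overlapG  u v = Intersect u v × ¬ StrictlyContains u v × ¬ StrictlyContains v u

Vertex : ∀ {n} → ILRep n → Set
Vertex {n} ρ = Σ (Pair n) (λ v → v ∈η ρ)

Adjacent : ∀ {n} (κ : Kind) (ρ : ILRep n) → Vertex ρ → Vertex ρ → Set
Adjacent κ ρ (u , _) (v , _) = (u ≢ v) × φ κ u v

allPairs : ∀ n → List (Pair n)
allPairs n = concatMap (λ a → map (a ,_) (allFin n)) (allFin n)

-- R = η ∪ {(t,t) : t ∈ S}, listed in lexicographic order
inR : ∀ {n} → ILRep n → Pair n → Bool
inR ρ (s₁ , s₂) = η ρ s₁ s₂ ∨ ⌊ s₁ ≟ s₂ ⌋

Rows : ∀ {n} → ILRep n → List (Pair n)
Rows {n} ρ = filterᵇ (inR ρ) (allPairs n)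

nRows : ∀ {n} → ILRep n → ℕ
nRows ρ = length (Rows ρ)

rowIndex : ∀ {n} (ρ : ILRep n) → Fin (nRows ρ) → Pair n
rowIndex ρ i = lookup (Rows ρ) i

ilEntry : ∀ {n} → ILRep n → Pair n → Fin n → ℕ
ilEntry ρ (s₁ , s₂) j =
  if ⌊ j <? s₁ ⌋ then 2
  else if η ρ s₁ s₂ ∧ ⌊ j ≟ s₂ ⌋ then 1
  else 0

ilMatrix : ∀ {n} (ρ : ILRep n) → Fin (nRows ρ) → Fin n → ℕ
ilMatrix ρ i j = ilEntry ρ (rowIndex ρ i) j

Matrix : ℕ → ℕ → Set
Matrix m c = Fin m → Fin c → ℕ

-- a partition of Fin m into k nonempty consecutive parts, given by the
-- map sending each index to its part: monotone and surjective
Monotone : ∀ {m k} → (Fin m → Fin k) → Set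
Monotone {m} f = ∀ (i j : Fin m) → i ≤ j → f i ≤ f j

record ConsecPartition (m k : ℕ) : Set where
  field
    part     : Fin m → Fin k
    part-mon : Monotone part
    part-sur : Surjective _≡_ _≡_ part
open ConsecPartition public

-- zone (a , b) has two distinct rows (they differ in some column of the
-- zone) and two distinct columns (they differ in some row of the zone)
MixedZone : ∀ {m c k} → Matrix m c → ConsecPartition m k → ConsecPartition c k
          → Fin k → Fin k → Set
MixedZone {m} {c} A P Q a b =
  (Σ (Fin m) λ r₁ → Σ (Fin m) λ r₂ → Σ (Fin c) λ j →
     part P r₁ ≡ a × part P r₂ ≡ a × part Q j ≡ b × A r₁ j ≢ A r₂ j)
  × (Σ (Fin c) λ j₁ → Σ (Fin c) λ j₂ → Σ (Fin m) λ r →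
     part Q j₁ ≡ b × part Q j₂ ≡ b × part P r ≡ a × A r j₁ ≢ A r j₂)

record MixedMinor {m c : ℕ} (k : ℕ) (A : Matrix m c) : Set where
  field
    rowPart : ConsecPartition m k
    colPart : ConsecPartition c k
    mixed   : ∀ a b → MixedZone A rowPart colPart a b

StrictlyIncreasing : ∀ {p m} → (Fin p → Fin m) → Set
StrictlyIncreasing {p} f = ∀ (i j : Fin p) → i < j → f i < f j

permEntry : ∀ {p} → (Fin p → Fin p) → Fin p → Fin p → ℕ
permEntry π i j = if ⌊ π i ≟ j ⌋ then 1 else 0

module Submission where

-- The rows of the il-representation matrix are sorted lexicographically by
-- (s₁, s₂), so the starts s₁ increase weakly along the row-parts of the mixed
-- minor.  The last row-part is mixed in column-part 0, so one of its rows has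
-- an entry other than 2 there, i.e. starts at or before a column of part 0.
-- Hence every row outside the last row-part starts before every column
-- outside column-part 0, and the entries of those zones are 0 or 1; being
-- mixed, each such zone contains a 1, i.e. a row of η whose end s₂ lies in the
-- column-part of the zone.  The 1s in the zones (2i, 2 + π i) form the
-- permutation matrix.  The 1s in the zones (2i + 1, 1) separate the chosen
-- rows: if the rows chosen in parts 2i < 2i′ had the same start, so would the
-- separator between them, which then ends later, i.e. the row of part 2i would
-- end in column-part at most 1 instead of 2 + π i.

open import Defs
open import Data.Nat as ℕ using (ℕ; suc; s≤s; z≤n; _+_; _*_; _≥_)
import Data.Nat.Properties as ℕₚ
open import Data.Fin as F using (Fin; toℕ; _≟_; _<?_)
import Data.Fin.Properties as Fₚ
open import Data.Fin.Permutation using (Permutation′; _⟨$⟩ʳ_; _⟨$⟩ˡ_; inverseˡ)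
open import Data.Bool using (true; false; if_then_else_)
open import Data.List using (List; map; allFin; lookup; length)
open import Data.List.Relation.Unary.All as All using (All; _∷_)
import Data.List.Relation.Unary.All.Properties as Allₚ
open import Data.List.Membership.Propositional.Properties using (∈-lookup)
open import Data.List.Relation.Unary.AllPairs using (AllPairs; _∷_)
import Data.List.Relation.Unary.AllPairs.Properties as AllPairsₚ
open import Data.Product using (Σ; _×_; _,_; proj₁; proj₂)
open import Data.Product.Relation.Binary.Lex.Strict using (×-Lex)
open import Data.Sum using (_⊎_; inj₁; inj₂)
open import Function using (_∘_)
open import Level using (0ℓ)
open import Relation.Binary using (Rel; tri<; tri≈; tri>)
open import Relation.Binary.PropositionalEquality
open import Relation.Nullary using (¬_; Dec; yes; no; contradiction)
open import Relation.Nullary.Decidable using (⌊_⌋)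

_<ₗₑₓ_ : ∀ {n} → Rel (Pair n) 0ℓ
_<ₗₑₓ_ = ×-Lex _≡_ F._<_ F._<_

AllPairs-lookup : ∀ {A : Set} {R : Rel A 0ℓ} {xs : List A} → AllPairs R xs →
                  ∀ {i j : Fin (length xs)} → i F.< j → R (lookup xs i) (lookup xs j)
AllPairs-lookup (Rx ∷ _)  {F.zero}  {F.suc j} _         = All.lookup Rx (∈-lookup j)
AllPairs-lookup (_ ∷ Rxs) {F.suc i} {F.suc j} (s≤s i<j) = AllPairs-lookup Rxs i<j

allPairs-sorted : ∀ n → AllPairs _<ₗₑₓ_ (allPairs n)
allPairs-sorted n = AllPairsₚ.concat⁺ (Allₚ.map⁺ (All.universal block-sorted (allFin n)))
                                      (AllPairsₚ.map⁺ (AllPairsₚ.tabulate⁺-< blocks-sorted))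
  where
  block : Fin n → List (Pair n)
  block a = map (a ,_) (allFin n)

  block-sorted : ∀ a → AllPairs _<ₗₑₓ_ (block a)
  block-sorted a = AllPairsₚ.map⁺ (AllPairsₚ.tabulate⁺-< λ j<j′ → inj₂ (refl , j<j′))

  blocks-sorted : ∀ {a b} → a F.< b → All (λ u → All (u <ₗₑₓ_) (block b)) (block a)
  blocks-sorted a<b = Allₚ.map⁺ (All.universal
    (λ _ → Allₚ.map⁺ (All.universal (λ _ → inj₁ a<b) (allFin n))) (allFin n))

part-reflects-< : ∀ {m k} (P : ConsecPartition m k) {x y : Fin m} →
                  part P x F.< part P y → x F.< y
part-reflects-< P {x} {y} px<py with Fₚ.<-cmp x y
... | tri< x<y _ _ = x<y
... | tri≈ _ refl _ = contradiction refl (Fₚ.<⇒≢ px<py)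
... | tri> _ _ y<x = contradiction (part-mon P y x (ℕₚ.<⇒≤ y<x)) (ℕₚ.<⇒≱ px<py)

part-index-reflects-< : ∀ {m k} (P : ConsecPartition m k) {x y : Fin m} {a b : ℕ} →
                        toℕ (part P x) ≡ a → toℕ (part P y) ≡ b → a ℕ.< b → x F.< y
part-index-reflects-< P x∈a y∈b a<b = part-reflects-< P (subst₂ ℕ._<_ (sym x∈a) (sym y∈b) a<b)

m<n⇒1+2m<2n : ∀ {m n} → m ℕ.< n → suc (2 * m) ℕ.< 2 * n
m<n⇒1+2m<2n {m} {n} m<n = subst (ℕ._≤ 2 * n) (ℕₚ.*-suc 2 m) (ℕₚ.*-monoʳ-≤ 2 m<n)

m<n⇒2m<2n : ∀ {m n} → m ℕ.< n → 2 * m ℕ.< 2 * n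
m<n⇒2m<2n m<n = ℕₚ.<-trans (ℕₚ.n<1+n _) (m<n⇒1+2m<2n m<n)

m<n⇒2+m≤2n : ∀ {m n} → m ℕ.< n → 2 + m ℕ.≤ 2 * n
m<n⇒2+m≤2n {m} {n} m<n = subst (2 + m ℕ.≤_) (cong (n +_) (sym (ℕₚ.+-identityʳ n)))
                                 (ℕₚ.+-mono-≤ (ℕₚ.≤-trans (s≤s z≤n) m<n) m<n)

module _ {n} (ρ : ILRep n) where

  rowStart rowEnd : Fin (nRows ρ) → Fin n
  rowStart = proj₁ ∘ rowIndex ρ
  rowEnd   = proj₂ ∘ rowIndex ρ

  rowIndex-<ₗₑₓ : ∀ {x y} → x F.< y → rowIndex ρ x <ₗₑₓ rowIndex ρ y
  rowIndex-<ₗₑₓ = AllPairs-lookup (AllPairsₚ.filter⁺ _ (allPairs-sorted n))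

  rowStart-mono : ∀ {x y} → x F.< y → rowStart x F.≤ rowStart y
  rowStart-mono x<y with rowIndex-<ₗₑₓ x<y
  ... | inj₁ s<s′       = ℕₚ.<⇒≤ s<s′
  ... | inj₂ (s≡s′ , _) = Fₚ.≤-reflexive s≡s′

  same-rowStart⇒rowEnd-< : ∀ {x y} → x F.< y → rowStart x ≡ rowStart y → rowEnd x F.< rowEnd y
  same-rowStart⇒rowEnd-< x<y s≡s′ with rowIndex-<ₗₑₓ x<y
  ... | inj₁ s<s′       = contradiction s≡s′ (Fₚ.<⇒≢ s<s′)
  ... | inj₂ (_ , e<e′) = e<e′

  squeezed⇒rowEnd-< : ∀ {x y z} → x F.< z → z F.< y → rowStart x ≡ rowStart y → rowEnd x F.< rowEnd z
  squeezed⇒rowEnd-< {z = z} x<z z<y sx≡sy = same-rowStart⇒rowEnd-< x<z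
    (Fₚ.≤-antisym (rowStart-mono x<z) (subst (rowStart z F.≤_) (sym sx≡sy) (rowStart-mono z<y)))

  ilEntry-left : ∀ {s j} → j F.< proj₁ s → ilEntry ρ s j ≡ 2
  ilEntry-left {s₁ , _} {j} j<s₁ with j <? s₁
  ... | yes _    = refl
  ... | no j≮s₁ = contradiction j<s₁ j≮s₁

  ilEntry-end : ∀ {s} → s ∈η ρ → ilEntry ρ s (proj₂ s) ≡ 1
  ilEntry-end {s₁ , s₂} s∈η with s₂ <? s₁ | s₂ ≟ s₂
  ... | yes s₂<s₁ | _         = contradiction (η-ord ρ s₁ s₂ s∈η) (ℕₚ.<⇒≱ s₂<s₁)
  ... | no _      | no s₂≢s₂ = contradiction refl s₂≢s₂
  ... | no _      | yes _ rewrite s∈η = refl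

  ilEntry-not-left : ∀ {s j} → ¬ j F.< proj₁ s → (s ∈η ρ × j ≡ proj₂ s) ⊎ ilEntry ρ s j ≡ 0
  ilEntry-not-left {s₁ , s₂} {j} j≮s₁ with j <? s₁
  ... | yes j<s₁ = contradiction j<s₁ j≮s₁
  ... | no _ with η ρ s₁ s₂ | j ≟ s₂
  ...   | true  | yes j≡s₂ = inj₁ (refl , j≡s₂)
  ...   | true  | no  _    = inj₂ refl
  ...   | false | _        = inj₂ refl

  ilEntry-off : ∀ {s j} → ¬ j F.< proj₁ s → j ≢ proj₂ s → ilEntry ρ s j ≡ 0
  ilEntry-off j≮s₁ j≢s₂ with ilEntry-not-left j≮s₁
  ... | inj₁ (_ , j≡s₂) = contradiction j≡s₂ j≢s₂
  ... | inj₂ entry≡0    = entry≡0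

module _ {n} (ρ : ILRep n) {k} (P : ConsecPartition (nRows ρ) k) (Q : ConsecPartition n k) where

  mixed⇒not-left : ∀ {a b} → MixedZone (ilMatrix ρ) P Q a b →
                   Σ (Fin (nRows ρ)) λ r → Σ (Fin n) λ j →
                     part P r ≡ a × part Q j ≡ b × ¬ j F.< rowStart ρ r
  mixed⇒not-left {a} {b} ((r₁ , r₂ , j , r₁∈a , r₂∈a , j∈b , differ) , _) =
    choose (j <? rowStart ρ r₁) (j <? rowStart ρ r₂)
    where
    choose : Dec (j F.< rowStart ρ r₁) → Dec (j F.< rowStart ρ r₂) →
             Σ (Fin (nRows ρ)) λ r → Σ (Fin n) λ j →
               part P r ≡ a × part Q j ≡ b × ¬ j F.< rowStart ρ r
    choose (no j≮s₁)  _          = r₁ , j , r₁∈a , j∈b , j≮s₁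
    choose (yes _)    (no j≮s₂)  = r₂ , j , r₂∈a , j∈b , j≮s₂
    choose (yes j<s₁) (yes j<s₂) =
      contradiction (trans (ilEntry-left ρ j<s₁) (sym (ilEntry-left ρ j<s₂))) differ

  mixed⇒rowStart-before : ∀ {a b r c} → MixedZone (ilMatrix ρ) P Q a b →
                          part P r F.< a → b F.< part Q c → rowStart ρ r F.< c
  mixed⇒rowStart-before {r = r} {c} zone r<a b<c with mixed⇒not-left zone
  ... | R , j , R∈a , j∈b , j≮sR = begin-strict
    toℕ (rowStart ρ r) ≤⟨ rowStart-mono ρ (part-reflects-< P (subst (part P r F.<_) (sym R∈a) r<a)) ⟩
    toℕ (rowStart ρ R) ≤⟨ ℕₚ.≮⇒≥ j≮sR ⟩
    toℕ j              <⟨ part-reflects-< Q (subst (F._< part Q c) (sym j∈b) b<c) ⟩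
    toℕ c              ∎
    where open ℕₚ.≤-Reasoning

  mixed⇒rowEnd-in-zone : ∀ {a b} → MixedZone (ilMatrix ρ) P Q a b →
                         (∀ {r c} → part P r ≡ a → part Q c ≡ b → rowStart ρ r F.≤ c) →
                         Σ (Fin (nRows ρ)) λ r → part P r ≡ a × rowIndex ρ r ∈η ρ × part Q (rowEnd ρ r) ≡ b
  mixed⇒rowEnd-in-zone {b = b} ((r₁ , r₂ , j , r₁∈a , r₂∈a , j∈b , differ) , _) starts-≤
    with ilEntry-not-left ρ (ℕₚ.≤⇒≯ (starts-≤ r₁∈a j∈b))
       | ilEntry-not-left ρ (ℕₚ.≤⇒≯ (starts-≤ r₂∈a j∈b))
  ... | inj₁ (r₁∈η , j≡e₁) | _                  = r₁ , r₁∈a , r₁∈η , subst (λ c → part Q c ≡ b) j≡e₁ j∈b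
  ... | inj₂ _             | inj₁ (r₂∈η , j≡e₂) = r₂ , r₂∈a , r₂∈η , subst (λ c → part Q c ≡ b) j≡e₂ j∈b
  ... | inj₂ a₁≡0          | inj₂ a₂≡0          = contradiction (trans a₁≡0 (sym a₂≡0)) differ

module PermutationMinor {n} (ρ : ILRep n) (p : ℕ) (M : MixedMinor (suc (2 * p)) (ilMatrix ρ))
                        (π : Permutation′ p) where

  open MixedMinor M

  rowStart-before-last : ∀ {r c} → toℕ (part rowPart r) ℕ.< 2 * p → 0 ℕ.< toℕ (part colPart c) →
                         rowStart ρ r F.< c
  rowStart-before-last r<last =
    mixed⇒rowStart-before ρ rowPart colPart (mixed (F.fromℕ (2 * p)) F.zero)
      (subst (toℕ (part rowPart _) ℕ.<_) (sym (Fₚ.toℕ-fromℕ (2 * p))) r<last)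

  record EndInZone (a b : ℕ) : Set where
    field
      row      : Fin (nRows ρ)
      row-part : toℕ (part rowPart row) ≡ a
      row-∈η   : rowIndex ρ row ∈η ρ
      end-part : toℕ (part colPart (rowEnd ρ row)) ≡ b
  open EndInZone

  endInZone : ∀ a b → a ℕ.< 2 * p → 0 ℕ.< b → b ℕ.≤ 2 * p → EndInZone a b
  endInZone a b a<last 0<b b≤last with mixed⇒rowEnd-in-zone ρ rowPart colPart (mixed a′ b′) rowStart≤
    where
    a′ b′ : Fin (suc (2 * p))
    a′ = F.fromℕ< (ℕₚ.m<n⇒m<1+n a<last)
    b′ = F.fromℕ< (s≤s b≤last)
    rowStart≤ : ∀ {r c} → part rowPart r ≡ a′ → part colPart c ≡ b′ → rowStart ρ r F.≤ c
    rowStart≤ r∈a c∈b = ℕₚ.<⇒≤ (rowStart-before-last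
      (subst (ℕ._< 2 * p) (sym (trans (cong toℕ r∈a) (Fₚ.toℕ-fromℕ< _))) a<last)
      (subst (0 ℕ.<_) (sym (trans (cong toℕ c∈b) (Fₚ.toℕ-fromℕ< _))) 0<b))
  ... | r , r∈a , r∈η , e∈b = record
    { row      = r
    ; row-part = trans (cong toℕ r∈a) (Fₚ.toℕ-fromℕ< _)
    ; row-∈η   = r∈η
    ; end-part = trans (cong toℕ e∈b) (Fₚ.toℕ-fromℕ< _)
    }

  gridOne : (i j : Fin p) → EndInZone (2 * toℕ i) (2 + toℕ j)
  gridOne i j = endInZone _ _ (m<n⇒2m<2n (Fₚ.toℕ<n i)) (s≤s z≤n) (m<n⇒2+m≤2n (Fₚ.toℕ<n j))

  separator : (i : Fin p) → EndInZone (suc (2 * toℕ i)) 1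
  separator i = endInZone _ _ 1+2i<2p (s≤s z≤n) (ℕₚ.≤-trans (s≤s z≤n) 1+2i<2p)
    where
    1+2i<2p : suc (2 * toℕ i) ℕ.< 2 * p
    1+2i<2p = m<n⇒1+2m<2n (Fₚ.toℕ<n i)

  rowOne : (i : Fin p) → EndInZone (2 * toℕ i) (2 + toℕ (π ⟨$⟩ʳ i))
  rowOne i = gridOne i (π ⟨$⟩ʳ i)

  colOne : (j : Fin p) → EndInZone (2 * toℕ (π ⟨$⟩ˡ j)) (2 + toℕ j)
  colOne j = gridOne (π ⟨$⟩ˡ j) j

  permRow : Fin p → Fin (nRows ρ)
  permRow i = row (rowOne i)

  permCol : Fin p → Fin n
  permCol j = rowEnd ρ (row (colOne j))

  permRow-increasing : StrictlyIncreasing permRow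
  permRow-increasing i i′ i<i′ =
    part-index-reflects-< rowPart (row-part (rowOne i)) (row-part (rowOne i′)) (m<n⇒2m<2n i<i′)

  permCol-increasing : StrictlyIncreasing permCol
  permCol-increasing j j′ j<j′ =
    part-index-reflects-< colPart (end-part (colOne j)) (end-part (colOne j′)) (s≤s (s≤s j<j′))

  permCol-π : ∀ i → permCol (π ⟨$⟩ʳ i) ≡ rowEnd ρ (permRow i)
  permCol-π i = cong (λ i′ → rowEnd ρ (row (gridOne i′ (π ⟨$⟩ʳ i)))) (inverseˡ π)

  permCol≡rowEnd⇒π : ∀ {i j} → permCol j ≡ rowEnd ρ (permRow i) → π ⟨$⟩ʳ i ≡ j
  permCol≡rowEnd⇒π {i} {j} c≡e = Fₚ.toℕ-injective (ℕₚ.+-cancelˡ-≡ 2 _ _ (begin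
    2 + toℕ (π ⟨$⟩ʳ i)                       ≡⟨ end-part (rowOne i) ⟨
    toℕ (part colPart (rowEnd ρ (permRow i))) ≡⟨ cong (toℕ ∘ part colPart) c≡e ⟨
    toℕ (part colPart (permCol j))            ≡⟨ end-part (colOne j) ⟩
    2 + toℕ j                                 ∎))
    where open ≡-Reasoning

  permEntries : ∀ i j → ilMatrix ρ (permRow i) (permCol j) ≡ permEntry (π ⟨$⟩ʳ_) i j
  permEntries i j = by-cases (π ⟨$⟩ʳ i ≟ j)
    where
    not-left : ¬ permCol j F.< rowStart ρ (permRow i)
    not-left = ℕₚ.<⇒≯ (rowStart-before-last
      (subst (ℕ._< 2 * p) (sym (row-part (rowOne i))) (m<n⇒2m<2n (Fₚ.toℕ<n i)))
      (subst (0 ℕ.<_) (sym (end-part (colOne j))) (s≤s z≤n)))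

    by-cases : (πi≟j : Dec (π ⟨$⟩ʳ i ≡ j)) →
               ilMatrix ρ (permRow i) (permCol j) ≡ (if ⌊ πi≟j ⌋ then 1 else 0)
    by-cases (yes πi≡j) = begin
      ilMatrix ρ (permRow i) (permCol j)               ≡⟨ cong (ilMatrix ρ (permRow i)) c≡e ⟩
      ilMatrix ρ (permRow i) (rowEnd ρ (permRow i))    ≡⟨ ilEntry-end ρ (row-∈η (rowOne i)) ⟩
      1                                                ∎
      where
      open ≡-Reasoning
      c≡e : permCol j ≡ rowEnd ρ (permRow i)
      c≡e = subst (λ j → permCol j ≡ rowEnd ρ (permRow i)) πi≡j (permCol-π i)
    by-cases (no πi≢j) = ilEntry-off ρ not-left (πi≢j ∘ permCol≡rowEnd⇒π)

  permRow-rowStarts-differ : ∀ {i i′} → i F.< i′ → rowStart ρ (permRow i) ≢ rowStart ρ (permRow i′)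
  permRow-rowStarts-differ {i} {i′} i<i′ same = ℕₚ.<⇒≱ (s≤s (s≤s z≤n)) (begin
    2 + toℕ (π ⟨$⟩ʳ i)                         ≡⟨ end-part (rowOne i) ⟨
    toℕ (part colPart (rowEnd ρ (permRow i)))  ≤⟨ part-mon colPart _ _ (ℕₚ.<⇒≤ ends-ordered) ⟩
    toℕ (part colPart (rowEnd ρ between))      ≡⟨ end-part (separator i) ⟩
    1                                          ∎)
    where
    open ℕₚ.≤-Reasoning
    between : Fin (nRows ρ)
    between = row (separator i)
    ends-ordered : rowEnd ρ (permRow i) F.< rowEnd ρ between
    ends-ordered = squeezed⇒rowEnd-< ρ
      (part-index-reflects-< rowPart (row-part (rowOne i)) (row-part (separator i)) (ℕₚ.n<1+n _))
      (part-index-reflects-< rowPart (row-part (separator i)) (row-part (rowOne i′)) (m<n⇒1+2m<2n i<i′))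
      same

  permRow-rowStarts-distinct : ∀ i i′ → i ≢ i′ → rowStart ρ (permRow i) ≢ rowStart ρ (permRow i′)
  permRow-rowStarts-distinct i i′ i≢i′ with Fₚ.<-cmp i i′
  ... | tri< i<i′ _ _ = permRow-rowStarts-differ i<i′
  ... | tri≈ _ i≡i′ _ = contradiction i≡i′ i≢i′
  ... | tri> _ _ i′<i = permRow-rowStarts-differ i′<i ∘ sym

lemma3p6 : (κ : Kind) (n : ℕ) (ρ : ILRep n) (p : ℕ) → p ≥ 1
    → MixedMinor (suc (2 * p)) (ilMatrix ρ)
    → (π : Permutation′ p)
    → Σ (Fin p → Fin (nRows ρ)) λ r → Σ (Fin p → Fin n) λ c →
        StrictlyIncreasing r × StrictlyIncreasing c
        × (∀ i j → ilMatrix ρ (r i) (c j) ≡ permEntry (π ⟨$⟩ʳ_) i j)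
        × (∀ i i′ → i ≢ i′ → proj₁ (rowIndex ρ (r i)) ≢ proj₁ (rowIndex ρ (r i′)))
lemma3p6 _ _ ρ p _ M π =
  permRow , permCol , permRow-increasing , permCol-increasing , permEntries , permRow-rowStarts-distinct
  where open PermutationMinor ρ p M π
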